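{- There is an absolute constant $c>0$ such that for every integer $n\ge 2$ and every point set $X=\{p_1,\dots,p_n\}$ with $p_i=(i,t_i)$, where $(t_1,\dots,t_n)$ is a permutation of $\{1,\dots,n\}$, the set $Y$ of points added by GreedyArb on input $X$ satisfies $$|X|+|Y|\;\le\; c\,\log n\cdot\bigl(|X|+|\mathrm{MinArb}(X)|\bigr).$$ That is, GreedyArb is $O(\log n)$-competitive.
   Context: Points are in $\mathbb{Z}^2$; the $x$-coordinate of a point $a$ is $a.x$ (the key) and its $y$-coordinate is $a.y$ (the time). For points $a,b$ not on a common horizontal or vertical line, $\Box ab$ denotes the closed axis-parallel rectangle with opposite corners $a$ and $b$. A pair $(a,b)$ of points is arborally satisfied with respect to a point set $P$ if $a$ and $b$ lie on a common horizontal or vertical line, or there exists $r\in P\setminus\{a,b\}$ lying in $\Box ab$ (interior or boundary). A point set $P$ is arborally satisfied if every pair of points of $P$ is arborally satisfied with respect to $P$. $\mathrm{MinArb}(X)$ denotes a minimum-cardinality point set $Y'$ such that $X\cup Y'$ is arborally satisfied. GreedyArb on input $X$: for $t=1,2,\dots,n$ in order, let $p$ be the unique point of $X$ with $p.y=t$, and let $Z_t$ be the set consisting of the points of $X$ with $y$-coordinate $<t$ together with all points added at earlier steps. The algorithm adds the set $M_p=\{(q.x,t): q\in Z_t,\ q.x\neq p.x,\ \text{and } \Box pq \text{ contains no point of } Z_t\cup\{p\} \text{ other than } p,q\}$. The output is $Y=\bigcup_{p\in X}M_p$. -}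

module Defs where

open import Data.Bool using (Bool; true; false; _∧_; _∨_; not; if_then_else_)
open import Data.Nat using (ℕ; suc)
open import Data.Integer using (ℤ; +_; _≤_; _≤ᵇ_; _⊓_; _⊔_)
import Data.Integer.Properties as ℤP
open import Data.Fin using (Fin; toℕ)
open import Data.Fin.Permutation using (Permutation′; _⟨$⟩ʳ_; _⟨$⟩ˡ_)
open import Data.List using (List; []; _∷_; _++_; map; filterᵇ; allFin; length; deduplicate)
open import Data.List.Membership.Propositional using (_∈_)
open import Data.Product using (_×_; _,_; proj₁; proj₂; ∃-syntax)
open import Data.Product.Properties using (≡-dec)
open import Data.Sum using (_⊎_)
open import Relation.Nullary using (does; ¬_)
open import Relation.Binary.PropositionalEquality using (_≡_)

-- A point of ℤ²: (x , y) = (key , time).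
Point : Set
Point = ℤ × ℤ

_≟ᴾ_ : (a b : Point) → Relation.Nullary.Dec (a ≡ b)
_≟ᴾ_ = ≡-dec ℤP._≟_ ℤP._≟_

InBox : Point → Point → Point → Set
InBox a b r =
  ((proj₁ a ⊓ proj₁ b) ≤ proj₁ r × proj₁ r ≤ (proj₁ a ⊔ proj₁ b)) ×
  ((proj₂ a ⊓ proj₂ b) ≤ proj₂ r × proj₂ r ≤ (proj₂ a ⊔ proj₂ b))

PairSat : List Point → Point → Point → Set
PairSat P a b =
  proj₁ a ≡ proj₁ b ⊎ proj₂ a ≡ proj₂ b ⊎
  (∃[ r ] (r ∈ P × ¬ (r ≡ a) × ¬ (r ≡ b) × InBox a b r))

ArbSat : List Point → Set
ArbSat P = ∀ a b → a ∈ P → b ∈ P → PairSat P a b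

allᵇ : {A : Set} → (A → Bool) → List A → Bool
allᵇ f [] = true
allᵇ f (x ∷ xs) = f x ∧ allᵇ f xs

_==ᴾ_ : Point → Point → Bool
a ==ᴾ b = does (a ≟ᴾ b)

_==ℤ_ : ℤ → ℤ → Bool
a ==ℤ b = does (a ℤP.≟ b)

inBoxᵇ : Point → Point → Point → Bool
inBoxᵇ a b r =
  ((proj₁ a ⊓ proj₁ b) ≤ᵇ proj₁ r) ∧ (proj₁ r ≤ᵇ (proj₁ a ⊔ proj₁ b)) ∧
  ((proj₂ a ⊓ proj₂ b) ≤ᵇ proj₂ r) ∧ (proj₂ r ≤ᵇ (proj₂ a ⊔ proj₂ b))

qualifies : List Point → Point → Point → Bool
qualifies Z p q =
  not (proj₁ q ==ℤ proj₁ p) ∧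
  allᵇ (λ r → (r ==ᴾ p) ∨ (r ==ᴾ q) ∨ not (inBoxᵇ p q r)) (p ∷ Z)

Mp : List Point → Point → List Point
Mp Z p = map (λ q → (proj₁ q , proj₂ p)) (filterᵇ (qualifies Z p) Z)

module _ {n : ℕ} (σ : Permutation′ n) where

  -- X = { p_i = (i , t_i) : i = 1..n }, with t_i = σ(i-1)+1 (Fin is 0-based).
  Xpts : List Point
  Xpts = map (λ i → (+ suc (toℕ i) , + suc (toℕ (σ ⟨$⟩ʳ i)))) (allFin n)

  pAt : Fin n → Point
  pAt j = (+ suc (toℕ (σ ⟨$⟩ˡ j)) , + suc (toℕ j))

  below : Fin n → List Point
  below j = filterᵇ (λ q → not ((+ suc (toℕ j)) ≤ᵇ proj₂ q)) Xpts

  greedyFrom : List (Fin n) → List Point → List Point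
  greedyFrom [] acc = acc
  greedyFrom (j ∷ js) acc = greedyFrom js (acc ++ Mp (below j ++ acc) (pAt j))

  GreedyY : List Point
  GreedyY = greedyFrom (allFin n) []

  cardY : ℕ
  cardY = length (deduplicate _≟ᴾ_ GreedyY)

-- GreedyArb adds O(n log n) points on every permutation, which already gives the bound since
-- |X| + |MinArb(X)| ≥ n.
--
-- Record the run as a staircase τ, where τ x is the time of the latest point with key x (0 if
-- none). At time t with key k, GreedyArb adds exactly one point above each key x visible from k:
-- x ≠ k and every column strictly between x and k, and k's own column, is lower than x's. After
-- the step k and the visible keys have height t. Let w(x) be the number of keys in the maximal
-- window around x of columns lower than x's, and Φ(τ) = Σₓ ⌊log₂ w(x)⌋. The keys visible on one
-- side of k form a chain. Before the step the window of a visible y contains every key from y to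
-- k; afterwards it fits strictly between the chain neighbours of y. With A and B the distances
-- from k to the nearer and the farther neighbour, 1 + log w′(y) + 2 log A ≤ log w(y) + 2 log B,
-- which telescopes along the chain. So a step adding s points lowers Φ by at least
-- s − 9 ⌊log₂ (n + 1)⌋; since Φ starts at 0 and stays nonnegative, |Y| ≤ 9 n ⌊log₂ (n + 1)⌋.

module Submission where

open import Defs
open import Data.Bool using (Bool; true; false; T; not; _∧_; _∨_)
open import Data.Bool.Properties using (T-∧; T?)
open import Data.Empty using (⊥)
open import Data.Fin as Fin using (Fin; toℕ)
open import Data.Fin.Properties using (toℕ<n; toℕ-injective)
open import Data.Fin.Permutation using (Permutation′; _⟨$⟩ʳ_; _⟨$⟩ˡ_; inverseˡ; inverseʳ)
open import Data.Integer using (+_)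
import Data.Integer as ℤ
import Data.Integer.Properties as ℤ
open import Data.List using (List; []; _∷_; [_]; _++_; map; filter; head; length; tabulate; allFin; deduplicate)
open import Data.List.Properties using (map-++; length-++; length-map; length-tabulate; filter-++; filter-reject)
open import Data.List.Membership.Propositional using (_∈_)
open import Data.List.Membership.Propositional.Properties
  using (∈-filter⁻; ∈-filter⁺; ∈-map⁺; ∈-map⁻; ∈-++⁺ˡ; ∈-++⁺ʳ; ∈-++⁻; ∈-allFin; ∈-deduplicate⁻)
open import Data.List.Relation.Unary.All as All using (All; all?)
open import Data.List.Relation.Unary.AllPairs using (_∷_)
open import Data.List.Relation.Unary.Any using (here; there)
open import Data.List.Relation.Unary.Unique.Propositional using (Unique)
open import Data.List.Relation.Unary.Unique.DecPropositional.Properties using (deduplicate-!)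
open import Data.Maybe using (fromMaybe)
open import Data.Nat
open import Data.Nat.ListAction using (sum)
open import Data.Nat.ListAction.Properties using (sum-++)
open import Data.Nat.Logarithm using (⌊log₂_⌋; ⌊log₂⌋-mono-≤; ⌊log₂[2*b]⌋≡1+⌊log₂b⌋; ⌊log₂[2^n]⌋≡n)
open import Data.Nat.Properties
open import Algebra.Properties.CommutativeSemigroup +-commutativeSemigroup using (x∙yz≈y∙xz; xy∙z≈xz∙y; interchange)
open import Data.Nat.Tactic.RingSolver using (solve; solve-∀)
open import Data.Product using (_×_; _,_; proj₁; proj₂; ∃-syntax)
open import Data.Sum using (_⊎_; inj₁; inj₂) renaming (map to map-⊎)
open import Data.Unit using (⊤; tt)
open import Function using (id; _∘_; Equivalence)
open import Level using (0ℓ)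
open import Relation.Binary using (tri<; tri≈; tri>)
open import Relation.Binary.PropositionalEquality hiding ([_])
open import Relation.Nullary using (¬_; Dec; yes; no; does; ¬?; _×-dec_; contradiction)
open import Relation.Unary using (Pred; Decidable)
open import Relation.Unary.Properties using (∁?)

⌊log₂[b+b]⌋≡1+⌊log₂b⌋ : ∀ b → 1 ≤ b → ⌊log₂ (b + b) ⌋ ≡ suc ⌊log₂ b ⌋
⌊log₂[b+b]⌋≡1+⌊log₂b⌋ b@(suc _) _ = trans (cong ⌊log₂_⌋ (cong (_+_ b) (sym (+-identityʳ b)))) (⌊log₂[2*b]⌋≡1+⌊log₂b⌋ b)

⌊log₂⌋-+-min : ∀ a c → 1 ≤ a → 1 ≤ c → suc ⌊log₂ a ⌋ ≤ ⌊log₂ (a + c) ⌋ ⊎ suc ⌊log₂ c ⌋ ≤ ⌊log₂ (a + c) ⌋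
⌊log₂⌋-+-min a c 1≤a 1≤c with ≤-total a c
... | inj₁ a≤c = inj₁ (subst (_≤ ⌊log₂ (a + c) ⌋) (⌊log₂[b+b]⌋≡1+⌊log₂b⌋ a 1≤a) (⌊log₂⌋-mono-≤ (+-monoʳ-≤ a a≤c)))
... | inj₂ c≤a = inj₂ (subst (_≤ ⌊log₂ (a + c) ⌋) (⌊log₂[b+b]⌋≡1+⌊log₂b⌋ c 1≤c) (⌊log₂⌋-mono-≤ (+-monoˡ-≤ c c≤a)))

⌊log₂⌋-amortized : ∀ {A W W′ B} → 1 ≤ A → 1 ≤ W′ → A ≤ W → W′ + A ≤ B →
                   suc ⌊log₂ W′ ⌋ + 2 * ⌊log₂ A ⌋ ≤ ⌊log₂ W ⌋ + 2 * ⌊log₂ B ⌋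
⌊log₂⌋-amortized {A} {W} {W′} {B} 1≤A 1≤W′ A≤W W′+A≤B =
  combine (mono A≤W) (mono (≤-trans (m≤n+m A W′) W′+A≤B)) (mono (≤-trans (m≤m+n W′ A) W′+A≤B))
          (map-⊎ (λ h → ≤-trans h (mono W′+A≤B)) (λ h → ≤-trans h (mono W′+A≤B)) (⌊log₂⌋-+-min W′ A 1≤W′ 1≤A))
  where
    mono = ⌊log₂⌋-mono-≤
    combine : ∀ {a b w w′} → a ≤ w → a ≤ b → w′ ≤ b → suc w′ ≤ b ⊎ suc a ≤ b → suc w′ + 2 * a ≤ w + 2 * b
    combine {a} {b} {w} {w′} a≤w a≤b w′≤b (inj₁ 1+w′≤b) = begin
      suc w′ + 2 * a     ≤⟨ +-mono-≤ 1+w′≤b (+-mono-≤ a≤w (+-monoˡ-≤ 0 a≤b)) ⟩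
      b + (w + (b + 0))  ≡⟨ solve (b ∷ w ∷ []) ⟩
      w + 2 * b          ∎
      where open ≤-Reasoning
    combine {a} {b} {w} {w′} a≤w a≤b w′≤b (inj₂ 1+a≤b) = begin
      suc w′ + 2 * a     ≡⟨ solve (w′ ∷ a ∷ []) ⟩
      suc a + (w′ + a)   ≤⟨ +-mono-≤ 1+a≤b (+-mono-≤ w′≤b a≤w) ⟩
      b + (b + w)        ≡⟨ solve (b ∷ w ∷ []) ⟩
      w + 2 * b          ∎
      where open ≤-Reasoning

2≤n⇒1≤⌊log₂n⌋ : ∀ {n} → 2 ≤ n → 1 ≤ ⌊log₂ n ⌋
2≤n⇒1≤⌊log₂n⌋ {n} 2≤n = subst (_≤ ⌊log₂ n ⌋) (⌊log₂[2^n]⌋≡n 1) (⌊log₂⌋-mono-≤ 2≤n)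

2≤n⇒⌊log₂[1+n]⌋≤2*⌊log₂n⌋ : ∀ {n} → 2 ≤ n → ⌊log₂ suc n ⌋ ≤ 2 * ⌊log₂ n ⌋
2≤n⇒⌊log₂[1+n]⌋≤2*⌊log₂n⌋ {n} 2≤n = begin
  ⌊log₂ suc n ⌋        ≤⟨ ⌊log₂⌋-mono-≤ (≤-trans (≤-reflexive (+-comm 1 n)) (+-monoʳ-≤ n (≤-trans (s≤s z≤n) 2≤n))) ⟩
  ⌊log₂ (n + n) ⌋      ≡⟨ ⌊log₂[b+b]⌋≡1+⌊log₂b⌋ n (≤-trans (s≤s z≤n) 2≤n) ⟩
  1 + ⌊log₂ n ⌋        ≤⟨ +-monoˡ-≤ ⌊log₂ n ⌋ (2≤n⇒1≤⌊log₂n⌋ 2≤n) ⟩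
  ⌊log₂ n ⌋ + ⌊log₂ n ⌋ ≡⟨ cong (_+_ ⌊log₂ n ⌋) (+-identityʳ ⌊log₂ n ⌋) ⟨
  2 * ⌊log₂ n ⌋        ∎
  where open ≤-Reasoning

m+n≤o≤p⇒m+[p∸o]≤p∸n : ∀ {m n o p} → m + n ≤ o → o ≤ p → m + (p ∸ o) ≤ p ∸ n
m+n≤o≤p⇒m+[p∸o]≤p∸n {m} {n} {o} {p} m+n≤o o≤p = m+n≤o⇒m≤o∸n (m + (p ∸ o)) (begin
  m + (p ∸ o) + n   ≡⟨ xy∙z≈xz∙y m (p ∸ o) n ⟩
  m + n + (p ∸ o)   ≤⟨ +-monoˡ-≤ (p ∸ o) m+n≤o ⟩
  o + (p ∸ o)       ≡⟨ m+[n∸m]≡n o≤p ⟩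
  p                 ∎)
  where open ≤-Reasoning

m+n≤o⇒m+[n∸p]≤o∸p : ∀ {m n o p} → m + n ≤ o → p ≤ n → m + (n ∸ p) ≤ o ∸ p
m+n≤o⇒m+[n∸p]≤o∸p {m} {n} {o} {p} m+n≤o p≤n = ≤-trans (≤-reflexive (sym (+-∸-assoc m p≤n))) (∸-monoˡ-≤ p m+n≤o)

≤-splice : ∀ {u v h u′ v′} → u ≤ v + h → u′ + h ≤ v′ → u + u′ ≤ v + v′
≤-splice {u} {v} {h} {u′} {v′} p q = +-cancelʳ-≤ h (u + u′) (v + v′) (begin
  u + u′ + h    ≡⟨ +-assoc u u′ h ⟩
  u + (u′ + h)  ≤⟨ +-mono-≤ p q ⟩
  v + h + v′    ≡⟨ solve (v ∷ h ∷ v′ ∷ []) ⟩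
  v + v′ + h    ∎)
  where open ≤-Reasoning

range : ℕ → ℕ → List ℕ
range s zero    = []
range s (suc m) = s ∷ range (suc s) m

∈-range⁺ : ∀ {s m x} → s ≤ x → x < s + m → x ∈ range s m
∈-range⁺ {s} {zero}  s≤x x<s = contradiction (≤-trans x<s (≤-trans (≤-reflexive (+-identityʳ s)) s≤x)) (<-irrefl refl)
∈-range⁺ {s} {suc m} s≤x x<s+m with m≤n⇒m<n∨m≡n s≤x
... | inj₂ refl = here refl
... | inj₁ s<x  = there (∈-range⁺ s<x (≤-trans x<s+m (≤-reflexive (+-suc s m))))

∈-range⁻ : ∀ {s m x} → x ∈ range s m → s ≤ x × x < s + m
∈-range⁻ {s} {suc m} (here refl) = ≤-refl , ≤-trans (m≤m+n (suc s) m) (≤-reflexive (sym (+-suc s m)))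
∈-range⁻ {s} {suc m} (there x∈) with ∈-range⁻ x∈
... | s<x , x<s+m = <⇒≤ s<x , ≤-trans x<s+m (≤-reflexive (sym (+-suc s m)))

range-++ : ∀ s a b → range s (a + suc b) ≡ range s a ++ (s + a) ∷ range (suc (s + a)) b
range-++ s zero    b rewrite +-identityʳ s = refl
range-++ s (suc a) b rewrite +-suc s a = cong (s ∷_) (range-++ (suc s) a b)

range-split : ∀ {k n} → 1 ≤ k → k ≤ n → range 1 n ≡ range 1 (pred k) ++ k ∷ range (suc k) (n ∸ k)
range-split {suc k} {n} _ k<n = begin
  range 1 n                                     ≡⟨ cong (range 1) (trans (+-suc k (n ∸ suc k)) (m+[n∸m]≡n k<n)) ⟨
  range 1 (k + suc (n ∸ suc k))                 ≡⟨ range-++ 1 k (n ∸ suc k) ⟩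
  range 1 k ++ suc k ∷ range (2 + k) (n ∸ suc k) ∎
  where open ≡-Reasoning

sum-map-suc : ∀ (h : ℕ → ℕ) xs → sum (map (suc ∘ h) xs) ≡ length xs + sum (map h xs)
sum-map-suc h []       = refl
sum-map-suc h (x ∷ xs) = cong suc (trans (cong (_+_ (h x)) (sum-map-suc h xs)) (x∙yz≈y∙xz (h x) (length xs) _))

sum-map-mono : ∀ {f g : ℕ → ℕ} xs → (∀ {x} → x ∈ xs → f x ≤ g x) → sum (map f xs) ≤ sum (map g xs)
sum-map-mono []       f≤g = z≤n
sum-map-mono (x ∷ xs) f≤g = +-mono-≤ (f≤g (here refl)) (sum-map-mono xs (f≤g ∘ there))

module _ {p} {P : Pred ℕ p} (P? : Decidable P) where

  sum-map-partition : ∀ h xs → sum (map h xs) ≡ sum (map h (filter P? xs)) + sum (map h (filter (∁? P?) xs))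
  sum-map-partition h []       = refl
  sum-map-partition h (x ∷ xs) with P? x
  ... | yes _ = trans (cong (_+_ (h x)) (sum-map-partition h xs)) (sym (+-assoc (h x) _ _))
  ... | no  _ = trans (cong (_+_ (h x)) (sum-map-partition h xs)) (x∙yz≈y∙xz (h x) (sum (map h (filter P? xs))) (sum (map h (filter (∁? P?) xs))))

  length-filter+sum-≤ : ∀ (f g : ℕ → ℕ) xs {C} →
                     sum (map (suc ∘ f) (filter P? xs)) ≤ sum (map g (filter P? xs)) + C →
                     (∀ {x} → x ∈ xs → ¬ P x → f x ≤ g x) →
                     length (filter P? xs) + sum (map f xs) ≤ sum (map g xs) + C
  length-filter+sum-≤ f g xs {C} kept dropped = begin
    length ys + sum (map f xs)                                ≡⟨ cong (_+_ (length ys)) (sum-map-partition f xs) ⟩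
    length ys + (sum (map f ys) + sum (map f zs))             ≡⟨ +-assoc (length ys) _ _ ⟨
    length ys + sum (map f ys) + sum (map f zs)               ≡⟨ cong (_+ sum (map f zs)) (sum-map-suc f ys) ⟨
    sum (map (suc ∘ f) ys) + sum (map f zs)                   ≤⟨ +-mono-≤ kept (sum-map-mono zs dropped′) ⟩
    sum (map g ys) + C + sum (map g zs)                       ≡⟨ xy∙z≈xz∙y (sum (map g ys)) C (sum (map g zs)) ⟩
    sum (map g ys) + sum (map g zs) + C                       ≡⟨ cong (_+ C) (sum-map-partition g xs) ⟨
    sum (map g xs) + C                                        ∎
    where open ≤-Reasoning
          ys = filter P? xs
          zs = filter (∁? P?) xs
          dropped′ : ∀ {x} → x ∈ zs → f x ≤ g x
          dropped′ x∈zs = let x∈xs , ¬Px = ∈-filter⁻ (∁? P?) x∈zs in dropped x∈xs ¬Px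

private
  remove : ∀ {A : Set} {x : A} {ys} → x ∈ ys → ∃[ ys′ ] (length ys ≡ suc (length ys′) × (∀ {z} → z ∈ ys → z ≢ x → z ∈ ys′))
  remove {ys = y ∷ ys} (here refl) = ys , refl , λ { (here refl) z≢y → contradiction refl z≢y ; (there z∈) _ → z∈ }
  remove {ys = y ∷ ys} (there x∈) with remove x∈
  ... | ys′ , len , keep = y ∷ ys′ , cong suc len , λ { (here refl) _ → here refl ; (there z∈) z≢x → there (keep z∈ z≢x) }

Unique-⊆⇒length≤ : ∀ {A : Set} {xs ys : List A} → Unique xs → (∀ {z} → z ∈ xs → z ∈ ys) → length xs ≤ length ys
Unique-⊆⇒length≤ {xs = []}     _              _  = z≤n
Unique-⊆⇒length≤ {xs = x ∷ xs} (x∉xs ∷ unique) xs⊆ys with remove (xs⊆ys (here refl))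
... | ys′ , len , keep = subst (suc (length xs) ≤_) (sym len)
  (s≤s (Unique-⊆⇒length≤ unique λ z∈ → keep (xs⊆ys (there z∈)) λ { refl → All.lookup x∉xs z∈ refl }))

-- Telescoping along chains

next : ℕ → List ℕ → ℕ
next top ys = fromMaybe top (head ys)

-- Chain R b ys top: R holds of every consecutive triple of b ∷ ys ++ [ top ].
Chain : (ℕ → ℕ → ℕ → Set) → ℕ → List ℕ → ℕ → Set
Chain R b []       top = ⊤
Chain R b (y ∷ ys) top = R b y (next top ys) × Chain R y ys top

record Link (P : Pred ℕ 0ℓ) (lo hi b y a : ℕ) : Set where
  field
    lo≤b : lo ≤ b
    b<y  : b < y
    y<a  : y < a
    a≤hi : a ≤ hi
    Py   : P y
    Pb   : b ≡ lo ⊎ P b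
    Pa   : a ≡ hi ⊎ P a

module _ {P : Pred ℕ 0ℓ} (P? : Decidable P) {lo hi : ℕ} where

  private
    RightEnd : ℕ → ℕ → Set
    RightEnd s a = s ≤ a × a ≤ hi × (a ≡ hi ⊎ P a)

    next-filter : ∀ s m → s + m ≡ hi → RightEnd s (next hi (filter P? (range s m)))
    next-filter s zero    s+0≡hi = ≤-trans (m≤m+n s 0) (≤-reflexive s+0≡hi) , ≤-refl , inj₁ refl
    next-filter s (suc m) s+m≡hi with P? s
    ... | yes Ps = ≤-refl , ≤-trans (m≤m+n s (suc m)) (≤-reflexive s+m≡hi) , inj₂ Ps
    ... | no  _ with next-filter (suc s) m (trans (sym (+-suc s m)) s+m≡hi)
    ...   | s<a , a≤hi , Pa = <⇒≤ s<a , a≤hi , Pa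

    chain-from : ∀ b s m → s + m ≡ hi → lo ≤ b → b < s → b ≡ lo ⊎ P b →
                 Chain (Link P lo hi) b (filter P? (range s m)) hi
    chain-from b s zero    _ _ _ _ = tt
    chain-from b s (suc m) s+m≡hi lo≤b b<s Pb with P? s | next-filter (suc s) m (trans (sym (+-suc s m)) s+m≡hi)
    ... | yes Ps | s<a , a≤hi , Pa =
      record { lo≤b = lo≤b ; b<y = b<s ; y<a = s<a ; a≤hi = a≤hi ; Py = Ps ; Pb = Pb ; Pa = Pa } ,
      chain-from s (suc s) m (trans (sym (+-suc s m)) s+m≡hi) (≤-trans lo≤b (<⇒≤ b<s)) ≤-refl (inj₂ Ps)
    ... | no _   | _ = chain-from b (suc s) m (trans (sym (+-suc s m)) s+m≡hi) lo≤b (m<n⇒m<1+n b<s) Pb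

  filter-range-chain : ∀ m → lo + suc m ≡ hi → Chain (Link P lo hi) lo (filter P? (range (suc lo) m)) hi
  filter-range-chain m lo+1+m≡hi = chain-from lo (suc lo) m (trans (sym (+-suc lo m)) lo+1+m≡hi) ≤-refl ≤-refl (inj₁ refl)

module _ {P : Pred ℕ 0ℓ} {lo hi : ℕ} (S T g : ℕ → ℕ) {M : ℕ} (g≤M : ∀ {x} → x ≤ hi → g x ≤ M) where

  private
    2g≤2M : ∀ {x} → x ≤ hi → 2 * g x ≤ 2 * M
    2g≤2M x≤hi = *-monoʳ-≤ 2 (g≤M x≤hi)

    twice-double : ∀ a m → a + 2 * m + 2 * m ≡ a + 4 * m
    twice-double = solve-∀

  telescope-ascending : (∀ {b y a} → Link P lo hi b y a → S y + 2 * g b ≤ T y + 2 * g a) →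
                        ∀ {b} ys → b ≤ hi → Chain (Link P lo hi) b ys hi →
                        sum (map S ys) ≤ sum (map T ys) + 4 * M
  telescope-ascending link {b} ys b≤hi chain = begin
    sum (map S ys)                                ≤⟨ ≤-trans (m≤m+n _ _) (m≤m+n _ _) ⟩
    sum (map S ys) + 2 * g b + 2 * g (next hi ys) ≤⟨ accumulate b ys b≤hi chain ⟩
    sum (map T ys) + 2 * g hi + 2 * M             ≤⟨ +-monoˡ-≤ (2 * M) (+-monoʳ-≤ (sum (map T ys)) (2g≤2M ≤-refl)) ⟩
    sum (map T ys) + 2 * M + 2 * M                ≡⟨ twice-double (sum (map T ys)) M ⟩
    sum (map T ys) + 4 * M                        ∎
    where
      open ≤-Reasoning
      accumulate : ∀ b ys → b ≤ hi → Chain (Link P lo hi) b ys hi →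
                   sum (map S ys) + 2 * g b + 2 * g (next hi ys) ≤ sum (map T ys) + 2 * g hi + 2 * M
      accumulate b []       b≤hi _            = subst (_≤ 2 * g hi + 2 * M) (+-comm (2 * g hi) (2 * g b)) (+-monoʳ-≤ (2 * g hi) (2g≤2M b≤hi))
      accumulate b (y ∷ ys) _    (l , chain) =
        subst₂ _≤_ (shuffle (S y) (2 * g b) (sum (map S ys)) (2 * g y))
                   (regroup (T y) (sum (map T ys)) (2 * g hi) (2 * M))
                   (≤-splice {v = T y} {h = 2 * g (next hi ys)} (link l) (accumulate y ys y≤hi chain))
        where y≤hi = <⇒≤ (<-≤-trans (Link.y<a l) (Link.a≤hi l))
              shuffle : ∀ a b c d → a + b + (c + d) ≡ a + c + b + d
              shuffle = solve-∀
              regroup : ∀ a b c d → a + (b + c + d) ≡ a + b + c + d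
              regroup = solve-∀

  telescope-descending : (∀ {b y a} → Link P lo hi b y a → S y + 2 * g a ≤ T y + 2 * g b) →
                         ∀ {b} ys → b ≤ hi → Chain (Link P lo hi) b ys hi →
                         sum (map S ys) ≤ sum (map T ys) + 4 * M
  telescope-descending link {b} ys b≤hi chain = begin
    sum (map S ys)                                 ≤⟨ accumulate b ys chain ⟩
    sum (map T ys) + 2 * g b + 2 * g (next hi ys)  ≤⟨ +-mono-≤ (+-monoʳ-≤ (sum (map T ys)) (2g≤2M b≤hi)) (2g≤2M (next≤hi ys chain)) ⟩
    sum (map T ys) + 2 * M + 2 * M                 ≡⟨ twice-double (sum (map T ys)) M ⟩
    sum (map T ys) + 4 * M                         ∎
    where
      open ≤-Reasoning
      next≤hi : ∀ {b} ys → Chain (Link P lo hi) b ys hi → next hi ys ≤ hi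
      next≤hi []      _       = ≤-refl
      next≤hi (y ∷ _) (l , _) = <⇒≤ (<-≤-trans (Link.y<a l) (Link.a≤hi l))
      accumulate : ∀ b ys → Chain (Link P lo hi) b ys hi → sum (map S ys) ≤ sum (map T ys) + 2 * g b + 2 * g (next hi ys)
      accumulate b []       _           = z≤n
      accumulate b (y ∷ ys) (l , chain) =
        subst₂ _≤_ (+-comm (sum (map S ys)) (S y))
                   (shuffle (sum (map T ys)) (2 * g y) (T y) (2 * g b))
                   (≤-splice {v = sum (map T ys) + 2 * g y} {h = 2 * g (next hi ys)} (accumulate y ys chain) (link l))
        where shuffle : ∀ a b c d → a + b + (c + d) ≡ c + a + d + b
              shuffle = solve-∀

-- Staircases

Between : ℕ → ℕ → ℕ → Set
Between k x z = (x < z × z ≤ k) ⊎ (k ≤ z × z < x)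

Between-≢ : ∀ {k x z} → Between k x z → z ≢ x
Between-≢ (inj₁ (x<z , _)) refl = <-irrefl refl x<z
Between-≢ (inj₂ (_ , z<x)) refl = <-irrefl refl z<x

gap : ℕ → ℕ → List ℕ
gap k x with x <? k
... | yes _ = range (suc x) (k ∸ x)
... | no  _ = range k (x ∸ k)

∈-gap⁺ : ∀ {k x z} → Between k x z → z ∈ gap k x
∈-gap⁺ {k} {x} {z} between with x <? k | between
... | yes x<k | inj₁ (x<z , z≤k) = ∈-range⁺ x<z (s≤s (≤-trans z≤k (≤-reflexive (sym (m+[n∸m]≡n (<⇒≤ x<k))))))
... | yes x<k | inj₂ (k≤z , z<x) = contradiction (<-trans x<k (≤-<-trans k≤z z<x)) (<-irrefl refl)
... | no  x≮k | inj₁ (x<z , z≤k) = contradiction (<-≤-trans x<z z≤k) x≮k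
... | no  x≮k | inj₂ (k≤z , z<x) = ∈-range⁺ k≤z (≤-trans z<x (≤-reflexive (sym (m+[n∸m]≡n (≮⇒≥ x≮k)))))

∈-gap⁻ : ∀ {k x z} → z ∈ gap k x → Between k x z
∈-gap⁻ {k} {x} {z} z∈ with x <? k
... | yes x<k = let x<z , z<k+1 = ∈-range⁻ z∈ in
  inj₁ (x<z , ≤-pred (≤-trans z<k+1 (≤-reflexive (cong suc (m+[n∸m]≡n (<⇒≤ x<k))))))
... | no  x≮k = let k≤z , z<x = ∈-range⁻ z∈ in
  inj₂ (k≤z , ≤-trans z<x (≤-reflexive (m+[n∸m]≡n (≮⇒≥ x≮k))))

Visible : (ℕ → ℕ) → ℕ → ℕ → Set
Visible τ k x = x ≢ k × All (λ z → τ z < τ x) (gap k x)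

visible? : ∀ τ k x → Dec (Visible τ k x)
visible? τ k x = ¬? (x ≟ k) ×-dec all? (λ z → τ z <? τ x) (gap k x)

visible : ∀ {τ k x} → x ≢ k → (∀ {z} → Between k x z → τ z < τ x) → Visible τ k x
visible x≢k below = x≢k , All.tabulate (λ z∈ → below (∈-gap⁻ z∈))

visible-below : ∀ {τ k x z} → Visible τ k x → Between k x z → τ z < τ x
visible-below (_ , below) between = All.lookup below (∈-gap⁺ between)

visible-above-key : ∀ {τ k x} → Visible τ k x → τ k < τ x
visible-above-key {k = k} {x} vis@(x≢k , _) with <-cmp x k
... | tri< x<k _ _ = visible-below vis (inj₁ (x<k , ≤-refl))
... | tri≈ _ x≡k _ = contradiction x≡k x≢k
... | tri> _ _ k<x = visible-below vis (inj₂ (≤-refl , k<x))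

update : (ℕ → ℕ) → ℕ → ℕ → ℕ → ℕ
update τ k t z with z ≟ k | visible? τ k z
... | yes _ | _     = t
... | no  _ | yes _ = t
... | no  _ | no  _ = τ z

update-raised : ∀ {τ k t z} → z ≡ k ⊎ Visible τ k z → update τ k t z ≡ t
update-raised {τ} {k} {t} {z} raised with z ≟ k | visible? τ k z
... | yes _ | _     = refl
... | no  _ | yes _ = refl
... | no z≢k | no invisible with raised
...   | inj₁ z≡k = contradiction z≡k z≢k
...   | inj₂ vis = contradiction vis invisible

update-other : ∀ {τ k t z} → z ≢ k → ¬ Visible τ k z → update τ k t z ≡ τ z
update-other {τ} {k} {t} {z} z≢k invisible with z ≟ k | visible? τ k z
... | yes z≡k | _       = contradiction z≡k z≢k
... | no  _   | yes vis = contradiction vis invisible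
... | no  _   | no  _   = refl

update-≥ : ∀ {τ k t} → (∀ z → τ z ≤ t) → ∀ z → τ z ≤ update τ k t z
update-≥ {τ} {k} {t} τ≤t z with z ≟ k | visible? τ k z
... | yes _ | _     = τ≤t z
... | no  _ | yes _ = τ≤t z
... | no  _ | no  _ = ≤-refl

update-≤ : ∀ {τ k t} → (∀ z → τ z ≤ t) → ∀ z → update τ k t z ≤ t
update-≤ {τ} {k} {t} τ≤t z with z ≟ k | visible? τ k z
... | yes _ | _     = ≤-refl
... | no  _ | yes _ = ≤-refl
... | no  _ | no  _ = τ≤t z

leftRun : (ℕ → ℕ) → ℕ → ℕ → ℕ
leftRun τ v zero = 0
leftRun τ v (suc m) with τ (suc m) <? v
... | yes _ = suc (leftRun τ v m)
... | no  _ = 0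

rightRun : (ℕ → ℕ) → ℕ → ℕ → ℕ → ℕ
rightRun τ v y zero = 0
rightRun τ v y (suc c) with τ y <? v
... | yes _ = suc (rightRun τ v (suc y) c)
... | no  _ = 0

width : ℕ → (ℕ → ℕ) → ℕ → ℕ
width n τ x = suc (leftRun τ (τ x) (pred x) + rightRun τ (τ x) (suc x) (n ∸ x))

leftRun-≤ : ∀ τ v m → leftRun τ v m ≤ m
leftRun-≤ τ v zero = z≤n
leftRun-≤ τ v (suc m) with τ (suc m) <? v
... | yes _ = s≤s (leftRun-≤ τ v m)
... | no  _ = z≤n

rightRun-≤ : ∀ τ v y c → rightRun τ v y c ≤ c
rightRun-≤ τ v y zero = z≤n
rightRun-≤ τ v y (suc c) with τ y <? v
... | yes _ = s≤s (rightRun-≤ τ v (suc y) c)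
... | no  _ = z≤n

leftRun-antitone : ∀ {τ τ′} → (∀ z → τ z ≤ τ′ z) → ∀ v m → leftRun τ′ v m ≤ leftRun τ v m
leftRun-antitone τ≤τ′ v zero = z≤n
leftRun-antitone {τ} {τ′} τ≤τ′ v (suc m) with τ′ (suc m) <? v | τ (suc m) <? v
... | no  _   | _       = z≤n
... | yes _   | yes _   = s≤s (leftRun-antitone τ≤τ′ v m)
... | yes τ′< | no  τ≮  = contradiction (≤-<-trans (τ≤τ′ (suc m)) τ′<) τ≮

rightRun-antitone : ∀ {τ τ′} → (∀ z → τ z ≤ τ′ z) → ∀ v y c → rightRun τ′ v y c ≤ rightRun τ v y c
rightRun-antitone τ≤τ′ v y zero = z≤n
rightRun-antitone {τ} {τ′} τ≤τ′ v y (suc c) with τ′ y <? v | τ y <? v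
... | no  _   | _       = z≤n
... | yes _   | yes _   = s≤s (rightRun-antitone τ≤τ′ v (suc y) c)
... | yes τ′< | no  τ≮  = contradiction (≤-<-trans (τ≤τ′ y) τ′<) τ≮

leftRun-blocked : ∀ {τ v b} m → b ≤ m → v ≤ τ b → leftRun τ v m + b ≤ m
leftRun-blocked zero b≤0 _ = b≤0
leftRun-blocked {τ} {v} {b} (suc m) b≤m v≤τb with τ (suc m) <? v | m≤n⇒m<n∨m≡n b≤m
... | yes τ<v | inj₂ refl = contradiction (<-≤-trans τ<v v≤τb) (<-irrefl refl)
... | yes _   | inj₁ b<m = s≤s (leftRun-blocked m (≤-pred b<m) v≤τb)
... | no  _   | _        = b≤m

rightRun-blocked : ∀ {τ v a} y c → y ≤ a → v ≤ τ a → rightRun τ v y c + y ≤ a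
rightRun-blocked y zero y≤a _ = y≤a
rightRun-blocked {τ} {v} {a} y (suc c) y≤a v≤τa with τ y <? v | m≤n⇒m<n∨m≡n y≤a
... | yes τ<v | inj₂ refl = contradiction (<-≤-trans τ<v v≤τa) (<-irrefl refl)
... | yes _   | inj₁ y<a = ≤-trans (≤-reflexive (sym (+-suc _ y))) (rightRun-blocked (suc y) c y<a v≤τa)
... | no  _   | _        = y≤a

leftRun-≥ : ∀ {τ v d} m → d ≤ m → (∀ z → z ≤ m → m < z + d → τ z < v) → d ≤ leftRun τ v m
leftRun-≥ {d = zero} m _ _ = z≤n
leftRun-≥ {τ} {v} {suc d} (suc m) d≤m below with τ (suc m) <? v
... | yes _   = s≤s (leftRun-≥ m (≤-pred d≤m) λ z z≤m m<z+d →
                  below z (m≤n⇒m≤1+n z≤m) (≤-trans (s≤s m<z+d) (≤-reflexive (sym (+-suc z d)))))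
... | no  τ≮v = contradiction (below (suc m) ≤-refl (m<m+n (suc m) z<s)) τ≮v

rightRun-≥ : ∀ {τ v d} y c → d ≤ c → (∀ z → y ≤ z → z < y + d → τ z < v) → d ≤ rightRun τ v y c
rightRun-≥ {d = zero} y c _ _ = z≤n
rightRun-≥ {τ} {v} {suc d} y (suc c) d≤c below with τ y <? v
... | yes _   = s≤s (rightRun-≥ (suc y) c (≤-pred d≤c) (λ z y<z z<y+d → below z (<⇒≤ y<z) (≤-trans z<y+d (≤-reflexive (sym (+-suc y d))))))
... | no  τ≮v = contradiction (below y ≤-refl (m<m+n y z<s)) τ≮v

width-≤ : ∀ n τ x → 1 ≤ x → x ≤ n → width n τ x ≤ n
width-≤ n τ (suc x) _ x<n = begin
  suc (leftRun τ v x + rightRun τ v (suc (suc x)) (n ∸ suc x)) ≤⟨ s≤s (+-mono-≤ (leftRun-≤ τ v x) (rightRun-≤ τ v _ _)) ⟩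
  suc (x + (n ∸ suc x))                                         ≡⟨ sym (+-suc x (n ∸ suc x)) ⟩
  x + suc (n ∸ suc x)                                           ≡⟨ cong (_+_ x) (+-∸-assoc 1 x<n) ⟨
  x + (suc n ∸ suc x)                                           ≡⟨ m+[n∸m]≡n (<⇒≤ x<n) ⟩
  n                                                             ∎
  where open ≤-Reasoning
        v = τ (suc x)

width-antitone : ∀ {n τ τ′} → (∀ z → τ z ≤ τ′ z) → ∀ {x} → τ′ x ≡ τ x → width n τ′ x ≤ width n τ x
width-antitone {n} {τ} τ≤τ′ {x} τ′x≡τx rewrite τ′x≡τx =
  s≤s (+-mono-≤ (leftRun-antitone τ≤τ′ (τ x) (pred x)) (rightRun-antitone τ≤τ′ (τ x) (suc x) (n ∸ x)))

width-fenced : ∀ {n τ b y a} → b < y → y < a → b ≡ 0 ⊎ τ y ≤ τ b → a ≡ suc n ⊎ τ y ≤ τ a →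
               width n τ y + b ≤ a
width-fenced {n} {τ} {b} {suc y} {a} b<y y<a fenceˡ fenceʳ = combine (left fenceˡ) (right fenceʳ)
  where
    v = τ (suc y)
    l = leftRun τ v y
    r = rightRun τ v (suc (suc y)) (n ∸ suc y)
    left : b ≡ 0 ⊎ v ≤ τ b → l + b ≤ y
    left (inj₁ refl) = ≤-trans (≤-reflexive (+-identityʳ l)) (leftRun-≤ τ v y)
    left (inj₂ v≤τb) = leftRun-blocked y (≤-pred b<y) v≤τb
    right : a ≡ suc n ⊎ v ≤ τ a → r + suc (suc y) ≤ a
    right (inj₁ refl) = ≤-trans (+-monoˡ-≤ (suc (suc y)) (rightRun-≤ τ v _ (n ∸ suc y)))
                               (≤-reflexive (trans (+-comm (n ∸ suc y) _) (cong suc (m+[n∸m]≡n (≤-pred y<a)))))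
    right (inj₂ v≤τa) = rightRun-blocked (suc (suc y)) (n ∸ suc y) y<a v≤τa
    combine : l + b ≤ y → r + suc (suc y) ≤ a → suc (l + r) + b ≤ a
    combine l+b≤y r+y≤a = begin
      suc (l + r) + b   ≡⟨ cong suc (xy∙z≈xz∙y l r b) ⟩
      suc (l + b + r)   ≤⟨ s≤s (+-monoˡ-≤ r l+b≤y) ⟩
      suc (y + r)       ≡⟨ +-comm (suc y) r ⟩
      r + suc y         ≤⟨ +-monoʳ-≤ r (n≤1+n (suc y)) ⟩
      r + suc (suc y)   ≤⟨ r+y≤a ⟩
      a                 ∎
      where open ≤-Reasoning

width-visible-left : ∀ {n τ k y} → Visible τ k y → y < k → k ≤ n → suc (k ∸ y) ≤ width n τ y
width-visible-left {n} {τ} {k} {y} vis y<k k≤n =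
  s≤s (≤-trans run (m≤n+m _ (leftRun τ (τ y) (pred y))))
  where
    run : k ∸ y ≤ rightRun τ (τ y) (suc y) (n ∸ y)
    run = rightRun-≥ (suc y) (n ∸ y) (∸-monoˡ-≤ y k≤n) λ z y<z z<1+k →
      visible-below vis (inj₁ (y<z , ≤-pred (≤-trans z<1+k (≤-reflexive (cong suc (m+[n∸m]≡n (<⇒≤ y<k)))))))

width-visible-right : ∀ {n τ k y} → Visible τ k y → k < y → 1 ≤ k → suc (y ∸ k) ≤ width n τ y
width-visible-right {n} {τ} {k} {suc y} vis k<y 1≤k =
  s≤s (≤-trans run (m≤m+n _ (rightRun τ (τ (suc y)) (suc (suc y)) (n ∸ suc y))))
  where
    k≤z : ∀ {z} → y < z + (suc y ∸ k) → k ≤ z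
    k≤z {z} y<z+d = +-cancelʳ-≤ (suc y) k z (begin
      k + suc y               ≡⟨ +-comm k (suc y) ⟩
      suc y + k               ≤⟨ +-monoˡ-≤ k y<z+d ⟩
      z + (suc y ∸ k) + k     ≡⟨ +-assoc z _ k ⟩
      z + ((suc y ∸ k) + k)   ≡⟨ cong (_+_ z) (m∸n+n≡m (<⇒≤ k<y)) ⟩
      z + suc y               ∎)
      where open ≤-Reasoning
    run : suc y ∸ k ≤ leftRun τ (τ (suc y)) y
    run = leftRun-≥ y (∸-monoʳ-≤ (suc y) 1≤k) λ z z≤y y<z+d →
      visible-below vis (inj₂ (k≤z y<z+d , s≤s z≤y))

-- Potential

potential : ℕ → (ℕ → ℕ) → ℕ
potential n τ = sum (map (λ x → ⌊log₂ width n τ x ⌋) (range 1 n))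

potential-flat : ∀ n → potential n (λ _ → 0) ≡ 0
potential-flat n = sum-zero (range 1 n)
  where
    leftRun-flat : ∀ m → leftRun (λ _ → 0) 0 m ≡ 0
    leftRun-flat zero    = refl
    leftRun-flat (suc m) = refl
    rightRun-flat : ∀ y c → rightRun (λ _ → 0) 0 y c ≡ 0
    rightRun-flat y zero    = refl
    rightRun-flat y (suc c) = refl
    sum-zero : ∀ xs → sum (map (λ x → ⌊log₂ width n (λ _ → 0) x ⌋) xs) ≡ 0
    sum-zero []       = refl
    sum-zero (x ∷ xs) rewrite leftRun-flat (pred x) | rightRun-flat (suc x) (n ∸ x) | sum-zero xs = ⌊log₂[2^n]⌋≡n 0

module _ (n : ℕ) {τ : ℕ → ℕ} {k t : ℕ} (1≤k : 1 ≤ k) (k≤n : k ≤ n) (τ≤t : ∀ z → τ z ≤ t) where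

  private
    τ′ : ℕ → ℕ
    τ′ = update τ k t

    g g′ : ℕ → ℕ
    g x = ⌊log₂ width n τ x ⌋
    g′ x = ⌊log₂ width n τ′ x ⌋

    F : ℕ
    F = ⌊log₂ suc n ⌋

    raised-level : ∀ {y z} → Visible τ k y → z ≡ k ⊎ Visible τ k z → τ′ y ≤ τ′ z
    raised-level vis raised = ≤-reflexive (trans (update-raised (inj₂ vis)) (sym (update-raised raised)))

    invisible-≤ : ∀ {x} → x ≢ k → ¬ Visible τ k x → g′ x ≤ g x
    invisible-≤ x≢k invisible = ⌊log₂⌋-mono-≤ (width-antitone (update-≥ τ≤t) (update-other x≢k invisible))

    Fˡ Fʳ : ℕ → ℕ
    Fˡ z = ⌊log₂ suc (k ∸ z) ⌋
    Fʳ z = ⌊log₂ suc (z ∸ k) ⌋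

    link-left : ∀ {b y a} → Link (Visible τ k) 0 k b y a → suc (g′ y) + 2 * Fˡ a ≤ g y + 2 * Fˡ b
    link-left {b} {y} {a} l = ⌊log₂⌋-amortized (s≤s z≤n) (s≤s z≤n) A≤W W′+A≤B
      where
        open Link l
        A≤W : suc (k ∸ a) ≤ width n τ y
        A≤W = ≤-trans (s≤s (∸-monoʳ-≤ k (<⇒≤ y<a))) (width-visible-left Py (<-≤-trans y<a a≤hi) k≤n)
        fenced : width n τ′ y + b ≤ a
        fenced = width-fenced b<y y<a (map-⊎ id (λ vis → raised-level Py (inj₂ vis)) Pb) (inj₂ (raised-level Py Pa))
        W′+A≤B : width n τ′ y + suc (k ∸ a) ≤ suc (k ∸ b)
        W′+A≤B = ≤-trans (≤-reflexive (+-suc (width n τ′ y) (k ∸ a))) (s≤s (m+n≤o≤p⇒m+[p∸o]≤p∸n fenced a≤hi))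

    link-right : ∀ {b y a} → Link (Visible τ k) k (suc n) b y a → suc (g′ y) + 2 * Fʳ b ≤ g y + 2 * Fʳ a
    link-right {b} {y} {a} l = ⌊log₂⌋-amortized (s≤s z≤n) (s≤s z≤n) A≤W W′+A≤B
      where
        open Link l
        A≤W : suc (b ∸ k) ≤ width n τ y
        A≤W = ≤-trans (s≤s (∸-monoˡ-≤ k (<⇒≤ b<y))) (width-visible-right Py (≤-<-trans lo≤b b<y) 1≤k)
        fenced : width n τ′ y + b ≤ a
        fenced = width-fenced b<y y<a (inj₂ (raised-level Py Pb)) (map-⊎ id (λ vis → raised-level Py (inj₂ vis)) Pa)
        W′+A≤B : width n τ′ y + suc (b ∸ k) ≤ suc (a ∸ k)
        W′+A≤B = ≤-trans (≤-reflexive (+-suc (width n τ′ y) (b ∸ k))) (s≤s (m+n≤o⇒m+[n∸p]≤o∸p fenced lo≤b))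

    cost : List ℕ → ℕ
    cost xs = length (filter (visible? τ k) xs) + sum (map g′ xs)

    cost-++ : ∀ xs ys → cost (xs ++ ys) ≡ cost xs + cost ys
    cost-++ xs ys = begin
      length (filter vis? (xs ++ ys)) + sum (map g′ (xs ++ ys))
        ≡⟨ cong₂ _+_ (trans (cong length (filter-++ vis? xs ys)) (length-++ (filter vis? xs)))
                     (trans (cong sum (map-++ g′ xs ys)) (sum-++ (map g′ xs) (map g′ ys))) ⟩
      length (filter vis? xs) + length (filter vis? ys) + (sum (map g′ xs) + sum (map g′ ys))
        ≡⟨ interchange (length (filter vis? xs)) _ _ _ ⟩
      cost xs + cost ys ∎
      where open ≡-Reasoning
            vis? = visible? τ k

    1+pred[k]≡k : suc (pred k) ≡ k
    1+pred[k]≡k = suc-pred k {{>-nonZero 1≤k}}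

    cost-left : cost (range 1 (pred k)) ≤ sum (map g (range 1 (pred k))) + 4 * F
    cost-left = length-filter+sum-≤ (visible? τ k) g′ g (range 1 (pred k)) telescoped
      λ x∈ → invisible-≤ (<⇒≢ (≤-trans (proj₂ (∈-range⁻ x∈)) (≤-reflexive 1+pred[k]≡k)))
      where
        Fˡ≤F : ∀ {x} → x ≤ k → Fˡ x ≤ F
        Fˡ≤F {x} _ = ⌊log₂⌋-mono-≤ (s≤s (≤-trans (m∸n≤m k x) k≤n))
        telescoped : sum (map (suc ∘ g′) (filter (visible? τ k) (range 1 (pred k))))
                     ≤ sum (map g (filter (visible? τ k) (range 1 (pred k)))) + 4 * F
        telescoped = telescope-descending (suc ∘ g′) g Fˡ Fˡ≤F link-left _ z≤n
                       (filter-range-chain (visible? τ k) (pred k) 1+pred[k]≡k)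

    cost-right : cost (range (suc k) (n ∸ k)) ≤ sum (map g (range (suc k) (n ∸ k))) + 4 * F
    cost-right = length-filter+sum-≤ (visible? τ k) g′ g (range (suc k) (n ∸ k)) telescoped
      λ x∈ → invisible-≤ (≢-sym (<⇒≢ (proj₁ (∈-range⁻ x∈))))
      where
        Fʳ≤F : ∀ {x} → x ≤ suc n → Fʳ x ≤ F
        Fʳ≤F {x} x≤1+n = ⌊log₂⌋-mono-≤ (s≤s (≤-trans (∸-monoʳ-≤ x 1≤k) (∸-monoˡ-≤ 1 x≤1+n)))
        telescoped : sum (map (suc ∘ g′) (filter (visible? τ k) (range (suc k) (n ∸ k))))
                     ≤ sum (map g (filter (visible? τ k) (range (suc k) (n ∸ k)))) + 4 * F
        telescoped = telescope-ascending (suc ∘ g′) g Fʳ Fʳ≤F link-right _ (m≤n⇒m≤1+n k≤n)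
                       (filter-range-chain (visible? τ k) (n ∸ k) (trans (+-suc k (n ∸ k)) (cong suc (m+[n∸m]≡n k≤n))))

    cost-key : cost [ k ] ≤ F
    cost-key rewrite filter-reject (visible? τ k) {xs = []} (λ vis → proj₁ vis refl) | +-identityʳ (g′ k) =
      ⌊log₂⌋-mono-≤ (m≤n⇒m≤1+n (width-≤ n τ′ k 1≤k k≤n))

  potential-amortized : length (filter (visible? τ k) (range 1 n)) + potential n (update τ k t) ≤ potential n τ + 9 * ⌊log₂ suc n ⌋
  potential-amortized = begin
    cost (range 1 n)                                 ≡⟨ cong cost (range-split 1≤k k≤n) ⟩
    cost (L ++ [ k ] ++ R)                           ≡⟨ trans (cost-++ L ([ k ] ++ R)) (cong (_+_ (cost L)) (cost-++ [ k ] R)) ⟩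
    cost L + (cost [ k ] + cost R)                   ≤⟨ +-mono-≤ cost-left (+-mono-≤ cost-key cost-right) ⟩
    (ΣL + 4 * F) + (F + (ΣR + 4 * F))                ≡⟨ collect ΣL ΣR F ⟩
    ΣL + ΣR + 9 * F                                  ≤⟨ +-monoˡ-≤ (9 * F) (+-monoʳ-≤ ΣL (m≤n+m ΣR (g k))) ⟩
    ΣL + (g k + ΣR) + 9 * F                          ≡⟨ cong (_+ 9 * F) (sum-++ (map g L) (map g (k ∷ R))) ⟨
    sum (map g L ++ map g (k ∷ R)) + 9 * F           ≡⟨ cong (λ xs → sum xs + 9 * F) (map-++ g L (k ∷ R)) ⟨
    sum (map g (L ++ k ∷ R)) + 9 * F                 ≡⟨ cong (λ xs → sum (map g xs) + 9 * F) (range-split 1≤k k≤n) ⟨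
    potential n τ + 9 * F                            ∎
    where
      open ≤-Reasoning
      L = range 1 (pred k)
      R = range (suc k) (n ∸ k)
      ΣL = sum (map g L)
      ΣR = sum (map g R)
      collect : ∀ a b c → (a + 4 * c) + (c + (b + 4 * c)) ≡ a + b + 9 * c
      collect = solve-∀

-- GreedyArb as a staircase process

Within : ℕ → ℕ → ℕ → Set
Within a b z = a ⊓ b ≤ z × z ≤ a ⊔ b

between⇒within : ∀ {k x z} → Between k x z → Within k x z
between⇒within {k} {x} (inj₁ (x<z , z≤k)) = ≤-trans (m⊓n≤n k x) (<⇒≤ x<z) , ≤-trans z≤k (m≤m⊔n k x)
between⇒within {k} {x} (inj₂ (k≤z , z<x)) = ≤-trans (m⊓n≤m k x) k≤z , ≤-trans (<⇒≤ z<x) (m≤n⊔m k x)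

within⇒between : ∀ {k x z} → x ≢ k → z ≢ x → Within k x z → Between k x z
within⇒between {k} {x} {z} x≢k z≢x (⊓≤z , z≤⊔) with <-cmp x k
... | tri< x<k _ _ = inj₁ (≤∧≢⇒< (subst (_≤ z) (m≥n⇒m⊓n≡n (<⇒≤ x<k)) ⊓≤z) (≢-sym z≢x) ,
                           subst (z ≤_) (m≥n⇒m⊔n≡m (<⇒≤ x<k)) z≤⊔)
... | tri≈ _ x≡k _ = contradiction x≡k x≢k
... | tri> _ _ k<x = inj₂ (subst (_≤ z) (m≤n⇒m⊓n≡m (<⇒≤ k<x)) ⊓≤z ,
                           ≤∧≢⇒< (subst (z ≤_) (m≤n⇒m⊔n≡n (<⇒≤ k<x)) z≤⊔) z≢x)

within-self : ∀ a b → Within a b b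
within-self a b = m⊓n≤n a b , m≤n⊔m a b

within⁺ : ∀ {t s z} → s ≤ z → z ≤ t → Within t s z
within⁺ {t} {s} s≤z z≤t = ≤-trans (m⊓n≤n t s) s≤z , ≤-trans z≤t (m≤m⊔n t s)

within⁻ : ∀ {t s z} → s ≤ t → Within t s z → s ≤ z
within⁻ s≤t (⊓≤z , _) = subst (_≤ _) (m≥n⇒m⊓n≡n s≤t) ⊓≤z

inBoxᵇ⁺ : ∀ {k t x s z s′} → Within k x z → Within t s s′ → T (inBoxᵇ (+ k , + t) (+ x , + s) (+ z , + s′))
inBoxᵇ⁺ (k⊓x≤z , z≤k⊔x) (t⊓s≤s′ , s′≤t⊔s) =
  ∧-intro (≤⇒≤ᵇ k⊓x≤z) (∧-intro (≤⇒≤ᵇ z≤k⊔x) (∧-intro (≤⇒≤ᵇ t⊓s≤s′) (≤⇒≤ᵇ s′≤t⊔s)))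
  where ∧-intro : ∀ {a b} → T a → T b → T (a ∧ b)
        ∧-intro ta tb = Equivalence.from T-∧ (ta , tb)

inBoxᵇ⁻ : ∀ {k t x s z s′} → T (inBoxᵇ (+ k , + t) (+ x , + s) (+ z , + s′)) → Within k x z × Within t s s′
inBoxᵇ⁻ {k} {t} {x} {s} {z} {s′} inbox =
  let b₁ , rest  = Equivalence.to T-∧ inbox
      b₂ , rest′ = Equivalence.to T-∧ rest
      b₃ , b₄    = Equivalence.to T-∧ rest′
  in (≤ᵇ⇒≤ _ _ b₁ , ≤ᵇ⇒≤ _ _ b₂) , (≤ᵇ⇒≤ _ _ b₃ , ≤ᵇ⇒≤ _ _ b₄)

T-not⁻ : ∀ {b} → T (not b) → ¬ T b
T-not⁻ {false} _ ()

T-not⁺ : ∀ {b} → ¬ T b → T (not b)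
T-not⁺ {false} _  = _
T-not⁺ {true}  ¬t = ¬t _

T-not-does⁻ : ∀ {A : Set} (a? : Dec A) → T (not (does a?)) → ¬ A
T-not-does⁻ (no ¬a) _ = ¬a

T-not-does⁺ : ∀ {A : Set} (a? : Dec A) → ¬ A → T (not (does a?))
T-not-does⁺ (yes a) ¬a = ¬a a
T-not-does⁺ (no  _) _  = _

∨-not-T⁻ : ∀ {A B : Set} (a? : Dec A) (b? : Dec B) c → T (does a? ∨ does b? ∨ not c) → ¬ A → ¬ B → ¬ T c
∨-not-T⁻ (yes a) _       _     _ ¬a _  _ = ¬a a
∨-not-T⁻ (no _)  (yes b) _     _ _  ¬b _ = ¬b b
∨-not-T⁻ (no _)  (no _)  true  () _ _
∨-not-T⁻ (no _)  (no _)  false _  _ _ ()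

∨-not-T⁺ : ∀ {A B : Set} (a? : Dec A) (b? : Dec B) c → (¬ A → ¬ B → ¬ T c) → T (does a? ∨ does b? ∨ not c)
∨-not-T⁺ (yes _) _       _     _     = _
∨-not-T⁺ (no _)  (yes _) _     _     = _
∨-not-T⁺ (no ¬a) (no ¬b) true  empty = empty ¬a ¬b _
∨-not-T⁺ (no _)  (no _)  false _     = _

allᵇ-lookup : ∀ {A : Set} {f : A → Bool} {xs x} → T (allᵇ f xs) → x ∈ xs → T (f x)
allᵇ-lookup {f = f} {y ∷ _} all (here refl) = proj₁ (Equivalence.to (T-∧ {f y}) all)
allᵇ-lookup {f = f} {y ∷ _} all (there x∈) = allᵇ-lookup (proj₂ (Equivalence.to (T-∧ {f y}) all)) x∈

allᵇ-tabulate : ∀ {A : Set} {f : A → Bool} xs → (∀ {x} → x ∈ xs → T (f x)) → T (allᵇ f xs)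
allᵇ-tabulate []       _   = _
allᵇ-tabulate (x ∷ xs) all = Equivalence.from T-∧ (all (here refl) , allᵇ-tabulate xs (all ∘ there))

EmptyBox : List Point → Point → Point → Set
EmptyBox Z p q = ∀ {r} → r ∈ Z → r ≢ p → r ≢ q → ¬ T (inBoxᵇ p q r)

qualifies⁻ : ∀ {Z p q} → T (qualifies Z p q) → proj₁ q ≢ proj₁ p × EmptyBox Z p q
qualifies⁻ {Z} {p} {q} qual =
  let distinct , empty = Equivalence.to T-∧ qual in
  T-not-does⁻ (proj₁ q ℤ.≟ proj₁ p) distinct ,
  λ {r} r∈Z → ∨-not-T⁻ (r ≟ᴾ p) (r ≟ᴾ q) (inBoxᵇ p q r)
    (allᵇ-lookup {f = λ s → (s ==ᴾ p) ∨ (s ==ᴾ q) ∨ not (inBoxᵇ p q s)} {xs = p ∷ Z} empty (there r∈Z))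

qualifies⁺ : ∀ {Z p q} → proj₁ q ≢ proj₁ p → EmptyBox Z p q → T (qualifies Z p q)
qualifies⁺ {Z} {p} {q} distinct empty =
  Equivalence.from T-∧ (T-not-does⁺ (proj₁ q ℤ.≟ proj₁ p) distinct , allᵇ-tabulate (p ∷ Z) emptyᵇ)
  where
    emptyᵇ : ∀ {r} → r ∈ p ∷ Z → T ((r ==ᴾ p) ∨ (r ==ᴾ q) ∨ not (inBoxᵇ p q r))
    emptyᵇ {r} (here refl) = ∨-not-T⁺ (r ≟ᴾ p) (r ≟ᴾ q) (inBoxᵇ p q r) (λ r≢p _ → contradiction refl r≢p)
    emptyᵇ {r} (there r∈Z) = ∨-not-T⁺ (r ≟ᴾ p) (r ≟ᴾ q) (inBoxᵇ p q r) (empty r∈Z)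

∈-Mp⁻ : ∀ {Z p z} → z ∈ Mp Z p → ∃[ q ] (q ∈ Z × T (qualifies Z p q) × z ≡ (proj₁ q , proj₂ p))
∈-Mp⁻ {Z} {p} z∈ with ∈-map⁻ (λ q → (proj₁ q , proj₂ p)) z∈
... | q , q∈ , refl = let q∈Z , qual = ∈-filter⁻ (T? ∘ qualifies Z p) q∈ in q , q∈Z , qual , refl

∈-Mp⁺ : ∀ {Z p q} → q ∈ Z → T (qualifies Z p q) → (proj₁ q , proj₂ p) ∈ Mp Z p
∈-Mp⁺ {Z} {p} q∈Z qual = ∈-map⁺ (λ q → (proj₁ q , proj₂ p)) (∈-filter⁺ (T? ∘ qualifies Z p) q∈Z qual)

Below : (ℕ → ℕ) → Point → Set
Below τ q = ∃[ x ] ∃[ s ] (q ≡ (+ x , + s) × 1 ≤ s × s ≤ τ x)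

Below-mono : ∀ {τ τ′ q} → (∀ z → τ z ≤ τ′ z) → Below τ q → Below τ′ q
Below-mono τ≤τ′ (x , s , refl , 1≤s , s≤τx) = x , s , refl , 1≤s , ≤-trans s≤τx (τ≤τ′ x)

module Simulation {n : ℕ} (σ : Permutation′ n) where

  key : Fin n → ℕ
  key j = suc (toℕ (σ ⟨$⟩ˡ j))

  row : (ℕ → ℕ) → Fin n → List Point
  row τ j = map (λ x → (+ x , + suc (toℕ j))) (filter (visible? τ (key j)) (range 1 n))

  run : List (Fin n) → (ℕ → ℕ) → List Point
  run []       τ = []
  run (j ∷ js) τ = row τ j ++ run js (update τ (key j) (suc (toℕ j)))

  Consecutive : ℕ → List (Fin n) → Set
  Consecutive m []       = ⊤
  Consecutive m (j ∷ js) = toℕ j ≡ m × Consecutive (suc m) js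

  -- After m steps τ is the staircase of the points present: all of them lie on or below it, and the
  -- top of every nonempty column is present.
  record Invariant (m : ℕ) (acc : List Point) (τ : ℕ → ℕ) : Set where
    field
      height-≤    : ∀ z → τ z ≤ m
      added-below : ∀ {q} → q ∈ acc → Below τ q
      input-below : ∀ i → suc (toℕ (σ ⟨$⟩ʳ i)) ≤ m → suc (toℕ (σ ⟨$⟩ʳ i)) ≤ τ (suc (toℕ i))
      top-present : ∀ {x} → 0 < τ x → (+ x , + τ x) ∈ Xpts σ ⊎ (+ x , + τ x) ∈ acc
      top-in-range : ∀ {x} → 0 < τ x → 1 ≤ x × x ≤ n

  pAt∈Xpts : ∀ j → pAt σ j ∈ Xpts σ
  pAt∈Xpts j = subst (λ i → (+ key j , + suc (toℕ i)) ∈ Xpts σ) (inverseʳ σ)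
                     (∈-map⁺ (λ i → (+ suc (toℕ i) , + suc (toℕ (σ ⟨$⟩ʳ i)))) (∈-allFin (σ ⟨$⟩ˡ j)))

  module Step (j : Fin n) (acc : List Point) (τ : ℕ → ℕ) (inv : Invariant (toℕ j) acc τ) where
    open Invariant inv

    private
      m t k : ℕ
      m = toℕ j
      t = suc m
      k = key j
      p = pAt σ j
      Z = below σ j ++ acc

      τ≤t : ∀ z → τ z ≤ t
      τ≤t z = m≤n⇒m≤1+n (height-≤ z)

      ≢p : ∀ {z s} → s ≤ m → (+ z , + s) ≢ p
      ≢p s≤m eq = <-irrefl (ℤ.+-injective (cong proj₂ eq)) (s≤s s≤m)

    Z-below : ∀ {q} → q ∈ Z → Below τ q
    Z-below q∈Z with ∈-++⁻ (below σ j) q∈Z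
    ... | inj₂ q∈acc = added-below q∈acc
    ... | inj₁ q∈below with ∈-filter⁻ (T? ∘ λ q → not (+ t ℤ.≤ᵇ proj₂ q)) {xs = Xpts σ} q∈below
    ...   | q∈X , earlier with ∈-map⁻ (λ i → (+ suc (toℕ i) , + suc (toℕ (σ ⟨$⟩ʳ i)))) q∈X
    ...     | i , _ , refl = suc (toℕ i) , suc (toℕ (σ ⟨$⟩ʳ i)) , refl , s≤s z≤n ,
                             input-below i (≤-pred (≰⇒> (T-not⁻ earlier ∘ ≤⇒≤ᵇ)))

    Z-top : ∀ {x} → 0 < τ x → (+ x , + τ x) ∈ Z
    Z-top {x} 0<τx with top-present 0<τx
    ... | inj₂ top∈acc = ∈-++⁺ʳ (below σ j) top∈acc
    ... | inj₁ top∈X   = ∈-++⁺ˡ (∈-filter⁺ (T? ∘ λ q → not (+ t ℤ.≤ᵇ proj₂ q)) top∈X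
                                   (T-not⁺ λ t≤τx → <-irrefl refl (≤-trans (≤ᵇ⇒≤ t (τ x) t≤τx) (height-≤ x))))

    -- A qualifying q is the top of its column, and no column between it and k reaches its height:
    -- either would put a point of Z into the empty box.
    qualifying⇒visible : ∀ {q} → q ∈ Z → T (qualifies Z p q) → ∃[ x ] (proj₁ q ≡ + x × Visible τ k x)
    qualifying⇒visible q∈Z qual with Z-below q∈Z
    ... | x , s , refl , 1≤s , s≤τx = x , refl , visible x≢k column-below
      where
        x≢k : x ≢ k
        x≢k x≡k = proj₁ (qualifies⁻ {Z} {p} qual) (cong +_ x≡k)
        blocked : ∀ {z s′} → (+ z , + s′) ∈ Z → s′ ≤ m → (+ z , + s′) ≢ (+ x , + s) → Within k x z → Within t s s′ → ⊥
        blocked r∈Z s′≤m r≢q wk wt = proj₂ (qualifies⁻ {Z} {p} qual) r∈Z (≢p s′≤m) r≢q (inBoxᵇ⁺ wk wt)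
        s≡τx : s ≡ τ x
        s≡τx = ≤-antisym s≤τx (≮⇒≥ λ s<τx →
          blocked (Z-top (≤-trans 1≤s (<⇒≤ s<τx))) (height-≤ x) (λ eq → >⇒≢ s<τx (ℤ.+-injective (cong proj₂ eq)))
                  (within-self k x) (within⁺ (<⇒≤ s<τx) (τ≤t x)))
        column-below : ∀ {z} → Between k x z → τ z < τ x
        column-below {z} btw = ≰⇒> λ τx≤τz →
          blocked (Z-top (≤-trans 1≤s (≤-trans s≤τx τx≤τz))) (height-≤ z) (λ eq → Between-≢ btw (ℤ.+-injective (cong proj₁ eq)))
                  (between⇒within btw) (within⁺ (≤-trans (≤-reflexive s≡τx) τx≤τz) (τ≤t z))

    visible⇒qualifying : ∀ {x} → Visible τ k x → T (qualifies Z p (+ x , + τ x))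
    visible⇒qualifying {x} vis = qualifies⁺ {Z} {p} (λ eq → proj₁ vis (ℤ.+-injective eq)) empty
      where
        empty : EmptyBox Z p (+ x , + τ x)
        empty r∈Z r≢p r≢q inbox with Z-below r∈Z
        ... | y , s′ , refl , _ , s′≤τy with inBoxᵇ⁻ inbox | y ≟ x
        ...   | _ , wt | yes refl = r≢q (cong (λ s → (+ y , + s)) (≤-antisym s′≤τy (within⁻ (τ≤t x) wt)))
        ...   | wk , wt | no y≢x  = <-irrefl refl (≤-trans (visible-below vis (within⇒between (proj₁ vis) y≢x wk))
                                                             (≤-trans (within⁻ (τ≤t x) wt) s′≤τy))

    visible-row : ∀ {x} → Visible τ k x → (+ x , + t) ∈ row τ j
    visible-row {x} vis = let 1≤x , x≤n = top-in-range (≤-<-trans z≤n (visible-above-key vis)) in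
      ∈-map⁺ (λ x → (+ x , + t)) (∈-filter⁺ (visible? τ k) (∈-range⁺ 1≤x (s≤s x≤n)) vis)

    added-visible : ∀ {z} → z ∈ Mp Z p → ∃[ x ] (z ≡ (+ x , + t) × Visible τ k x)
    added-visible z∈M with ∈-Mp⁻ {Z} {p} z∈M
    ... | q , q∈Z , qual , refl with qualifying⇒visible q∈Z qual
    ...   | x , qx≡x , vis = x , cong (_, + t) qx≡x , vis

    invariant-step : Invariant t (acc ++ Mp Z p) (update τ k t)
    invariant-step = record
      { height-≤     = update-≤ {k = k} τ≤t
      ; added-below  = λ {q} q∈ → added-below′ (∈-++⁻ acc q∈)
      ; input-below  = input-below′
      ; top-present  = top-present′
      ; top-in-range = top-in-range′
      }
      where
        τ′ = update τ k t

        added-below′ : ∀ {q} → q ∈ acc ⊎ q ∈ Mp Z p → Below τ′ q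
        added-below′ (inj₁ q∈acc) = Below-mono (update-≥ {k = k} τ≤t) (added-below q∈acc)
        added-below′ (inj₂ q∈M) with added-visible q∈M
        ... | x , refl , vis = x , t , refl , s≤s z≤n , ≤-reflexive (sym (update-raised {t = t} (inj₂ vis)))

        input-below′ : ∀ i → suc (toℕ (σ ⟨$⟩ʳ i)) ≤ t → suc (toℕ (σ ⟨$⟩ʳ i)) ≤ τ′ (suc (toℕ i))
        input-below′ i σi<t with m≤n⇒m<n∨m≡n σi<t
        ... | inj₁ σi<m = ≤-trans (input-below i (≤-pred σi<m)) (update-≥ {k = k} τ≤t (suc (toℕ i)))
        ... | inj₂ σi≡m = subst (λ x → suc (toℕ (σ ⟨$⟩ʳ i)) ≤ τ′ x) (cong (suc ∘ toℕ) j↦i)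
                                (≤-trans σi<t (≤-reflexive (sym (update-raised {τ} {k} {t} (inj₁ refl)))))
          where j↦i : σ ⟨$⟩ˡ j ≡ i
                j↦i = trans (cong (σ ⟨$⟩ˡ_) (sym (toℕ-injective (suc-injective σi≡m)))) (inverseˡ σ)

        top-present′ : ∀ {x} → 0 < τ′ x → (+ x , + τ′ x) ∈ Xpts σ ⊎ (+ x , + τ′ x) ∈ acc ++ Mp Z p
        top-present′ {x} 0<τ′x with x ≟ k | visible? τ k x
        ... | yes refl | _     = inj₁ (pAt∈Xpts j)
        ... | no _     | yes vis =
          inj₂ (∈-++⁺ʳ acc (∈-Mp⁺ {Z} {p} (Z-top (≤-<-trans z≤n (visible-above-key vis))) (visible⇒qualifying vis)))
        ... | no _     | no _  = map-⊎ id ∈-++⁺ˡ (top-present 0<τ′x)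

        top-in-range′ : ∀ {x} → 0 < τ′ x → 1 ≤ x × x ≤ n
        top-in-range′ {x} 0<τ′x with x ≟ k | visible? τ k x
        ... | yes refl | _       = s≤s z≤n , toℕ<n (σ ⟨$⟩ˡ j)
        ... | no _     | yes vis = top-in-range (≤-<-trans z≤n (visible-above-key vis))
        ... | no _     | no _    = top-in-range 0<τ′x

  greedy⊆run : ∀ {m} js acc τ → Consecutive m js → Invariant m acc τ →
               ∀ {z} → z ∈ greedyFrom σ js acc → z ∈ acc ⊎ z ∈ run js τ
  greedy⊆run []       acc τ _ _ z∈ = inj₁ z∈
  greedy⊆run (j ∷ js) acc τ (refl , consecutive) inv z∈
    with greedy⊆run js _ _ consecutive (Step.invariant-step j acc τ inv) z∈
  ... | inj₂ z∈run = inj₂ (∈-++⁺ʳ (row τ j) z∈run)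
  ... | inj₁ z∈acc′ with ∈-++⁻ acc z∈acc′
  ...   | inj₁ z∈acc = inj₁ z∈acc
  ...   | inj₂ z∈M with Step.added-visible j acc τ inv z∈M
  ...     | x , refl , vis = inj₂ (∈-++⁺ˡ (Step.visible-row j acc τ inv vis))

  run-length : ∀ {m} js τ → Consecutive m js → (∀ z → τ z ≤ m) →
               length (run js τ) ≤ potential n τ + length js * (9 * ⌊log₂ suc n ⌋)
  run-length []       τ _ _ = z≤n
  run-length (j ∷ js) τ (refl , consecutive) τ≤m = begin
    length (row τ j ++ run js τ′)                        ≡⟨ length-++ (row τ j) ⟩
    length (row τ j) + length (run js τ′)                ≡⟨ cong (_+ length (run js τ′)) (length-map _ V) ⟩
    length V + length (run js τ′)                        ≤⟨ +-monoʳ-≤ (length V) (run-length js τ′ consecutive τ′≤t) ⟩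
    length V + (potential n τ′ + length js * C)          ≡⟨ +-assoc (length V) (potential n τ′) (length js * C) ⟨
    length V + potential n τ′ + length js * C            ≤⟨ +-monoˡ-≤ (length js * C) amortized ⟩
    potential n τ + C + length js * C                    ≡⟨ +-assoc (potential n τ) C _ ⟩
    potential n τ + length (j ∷ js) * C                  ∎
    where
      open ≤-Reasoning
      C = 9 * ⌊log₂ suc n ⌋
      V = filter (visible? τ (key j)) (range 1 n)
      τ′ = update τ (key j) (suc (toℕ j))
      τ≤t : ∀ z → τ z ≤ suc (toℕ j)
      τ≤t z = m≤n⇒m≤1+n (τ≤m z)
      τ′≤t : ∀ z → τ′ z ≤ suc (toℕ j)
      τ′≤t = update-≤ {k = key j} τ≤t
      amortized : length V + potential n τ′ ≤ potential n τ + C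
      amortized = potential-amortized n (s≤s z≤n) (toℕ<n (σ ⟨$⟩ˡ j)) τ≤t

  consecutive-tabulate : ∀ {k} (f : Fin k → Fin n) m → (∀ i → toℕ (f i) ≡ m + toℕ i) → Consecutive m (tabulate f)
  consecutive-tabulate {zero}  f m _     = tt
  consecutive-tabulate {suc k} f m toℕ-f = trans (toℕ-f Fin.zero) (+-identityʳ m) ,
    consecutive-tabulate (f ∘ Fin.suc) (suc m) λ i → trans (toℕ-f (Fin.suc i)) (+-suc m (toℕ i))

  invariant-initial : Invariant 0 [] (λ _ → 0)
  invariant-initial = record { height-≤ = λ _ → z≤n ; added-below = λ () ; input-below = λ _ () ; top-present = λ () ; top-in-range = λ () }

  cardY-≤ : cardY σ ≤ n * (9 * ⌊log₂ suc n ⌋)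
  cardY-≤ = begin
    length (deduplicate _≟ᴾ_ (GreedyY σ))                        ≤⟨ Unique-⊆⇒length≤ (deduplicate-! _≟ᴾ_ (GreedyY σ)) greedy⊆ ⟩
    length (run (allFin n) (λ _ → 0))                           ≤⟨ run-length (allFin n) (λ _ → 0) from-0 (λ _ → z≤n) ⟩
    potential n (λ _ → 0) + length (allFin n) * C               ≡⟨ cong₂ (λ Φ₀ l → Φ₀ + l * C) (potential-flat n) (length-tabulate {n = n} id) ⟩
    n * C                                                       ∎
    where
      open ≤-Reasoning
      C = 9 * ⌊log₂ suc n ⌋
      from-0 : Consecutive 0 (allFin n)
      from-0 = consecutive-tabulate id 0 (λ _ → refl)
      greedy⊆ : ∀ {z} → z ∈ deduplicate _≟ᴾ_ (GreedyY σ) → z ∈ run (allFin n) (λ _ → 0)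
      greedy⊆ z∈ with greedy⊆run (allFin n) [] (λ _ → 0) from-0 invariant-initial (∈-deduplicate⁻ _≟ᴾ_ (GreedyY σ) z∈)
      ... | inj₁ ()
      ... | inj₂ z∈run = z∈run

theorem1 : ∃[ c ] (0 < c × (∀ (n : ℕ) → 2 ≤ n → (σ : Permutation′ n) → (Y′ : List Point) →
             ArbSat (Xpts σ ++ Y′) →
             n + cardY σ ≤ c * ⌊log₂ n ⌋ * (n + length Y′)))
theorem1 = 19 , s≤s z≤n , λ n 2≤n σ Y′ _ → begin
  n + cardY σ                             ≤⟨ +-monoʳ-≤ n (Simulation.cardY-≤ σ) ⟩
  n + n * (9 * ⌊log₂ suc n ⌋)             ≤⟨ +-monoʳ-≤ n (*-monoʳ-≤ n (*-monoʳ-≤ 9 (2≤n⇒⌊log₂[1+n]⌋≤2*⌊log₂n⌋ 2≤n))) ⟩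
  n + n * (9 * (2 * ⌊log₂ n ⌋))           ≤⟨ +-monoˡ-≤ _ (subst (_≤ n * ⌊log₂ n ⌋) (*-identityʳ n) (*-monoʳ-≤ n (2≤n⇒1≤⌊log₂n⌋ 2≤n))) ⟩
  n * ⌊log₂ n ⌋ + n * (9 * (2 * ⌊log₂ n ⌋)) ≡⟨ collect n ⌊log₂ n ⌋ ⟩
  19 * ⌊log₂ n ⌋ * n                      ≤⟨ *-monoʳ-≤ (19 * ⌊log₂ n ⌋) (m≤m+n n (length Y′)) ⟩
  19 * ⌊log₂ n ⌋ * (n + length Y′)        ∎
  where open ≤-Reasoning
        collect : ∀ n l → n * l + n * (9 * (2 * l)) ≡ 19 * l * n
        collect = solve-∀
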